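{- Writing $k$ for the Nim heap of size $k$: (A) $m\equiv n$ for all $m,n\ge 3$; (B) $1+m\equiv 1+n$ for all $m,n\ge 2$; (C) for every game $G$ and all $m,n\ge 2$, $G+m+n\equiv 2+2$.
   Context: A (finite impartial) game is defined recursively as a finite set of games, its options; $0$ is the game with no options. Three players alternate moves cyclically; a move replaces the current game by one of its options, and the player who makes the last move wins. The disjunctive sum $G+H$ is the game whose options are all $G'+H$ and all $G+H'$. Types are defined recursively: $G$ is of type $\mathcal N$ iff it has some option of type $\mathcal P$; of type $\mathcal O$ iff it has at least one option and all its options are of type $\mathcal N$; of type $\mathcal P$ iff all its options are of type $\mathcal O$; of type $\mathcal Q$ otherwise. $G\equiv H$ (equivalence) means that for every game $X$, $G+X$ and $H+X$ have the same type. The Nim heap of size $n$ is the game whose options are the heaps of sizes $0,1,\dots,n-1$. -}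

module Defs where

open import Data.Nat using (ℕ; zero; suc)
open import Data.List using (List; []; _∷_; _++_)
open import Data.Bool using (Bool; true; false; _∧_; _∨_; if_then_else_)
open import Relation.Binary.PropositionalEquality using (_≡_)

-- A finite impartial game: given by its (finite) list of options.
-- (Duplicates/order are irrelevant for everything defined below.)
data Game : Set where
  mk : List Game → Game

options : Game → List Game
options (mk gs) = gs

mutual
  infixl 6 _⊕_
  _⊕_ : Game → Game → Game
  g@(mk gs) ⊕ h@(mk hs) = mk (lefts gs h ++ rights g hs)

  lefts : List Game → Game → List Game
  lefts [] h = []
  lefts (g ∷ gs) h = (g ⊕ h) ∷ lefts gs h

  rights : Game → List Game → List Game
  rights g [] = []
  rights g (h ∷ hs) = (g ⊕ h) ∷ rights g hs

mutual
  nim : ℕ → Game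
  nim n = mk (heaps n)

  heaps : ℕ → List Game
  heaps zero = []
  heaps (suc n) = heaps n ++ (nim n ∷ [])

-- The four types of three-player games.
data GameType : Set where
  𝒩 𝒪 𝒫 𝒬 : GameType

isN isO isP : GameType → Bool
isN 𝒩 = true
isN _ = false
isO 𝒪 = true
isO _ = false
isP 𝒫 = true
isP _ = false

anyB allB : (GameType → Bool) → List GameType → Bool
anyB p [] = false
anyB p (t ∷ ts) = p t ∨ anyB p ts
allB p [] = true
allB p (t ∷ ts) = p t ∧ allB p ts

nonEmpty : List GameType → Bool
nonEmpty [] = false
nonEmpty (_ ∷ _) = true

classify : List GameType → GameType
classify ts =
  if anyB isP ts then 𝒩
  else if nonEmpty ts ∧ allB isN ts then 𝒪
  else if allB isO ts then 𝒫
  else 𝒬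

mutual
  type : Game → GameType
  type (mk gs) = classify (types gs)

  types : List Game → List GameType
  types [] = []
  types (g ∷ gs) = type g ∷ types gs

infix 4 _≈g_
_≈g_ : Game → Game → Set
G ≈g H = ∀ (X : Game) → type (G ⊕ X) ≡ type (H ⊕ X)

{-# OPTIONS --safe #-}
-- A game S with moves S ⟶ a, S ⟶ b and b ⟶ a is never 𝒫: a would be both 𝒪 (an option of
-- the 𝒫-game S) and 𝒩 (an option of the 𝒪-game b). A sum containing a Nim heap of size at
-- least 2 has such moves (to heaps 1 and 0). So for m ≥ 3 the game m + X is 𝒩 if 0 + X or
-- 1 + X is 𝒫; otherwise none of its options is 𝒫 and its option 2 + X is not 𝒩, so it is 𝒬
-- whatever m is. The same works for 1 + m + X, where m = 2 needs a look two moves ahead, and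
-- for G + m + n + X, which is always 𝒬.
module Submission where

open import Data.Bool using (true; false; _∧_)
open import Data.Bool.Properties using (∧-conicalˡ; ∧-conicalʳ)
open import Data.Empty using (⊥; ⊥-elim)
open import Data.List using (_∷_; []; _++_; map)
open import Data.List.Membership.Propositional using (_∈_)
open import Data.List.Membership.Propositional.Properties using (∈-map⁺; ∈-map⁻; ∈-++⁺ˡ; ∈-++⁺ʳ; ∈-++⁻)
open import Data.List.Relation.Unary.Any using (here; there)
open import Data.Nat using (ℕ; zero; suc; _+_; _≤_; _<_; s≤s; z≤n)
open import Data.Nat.Properties using (≤-refl; ≤-trans; n<1+n; n≤1+n; m<n⇒m<1+n; m<1+n⇒m<n∨m≡n)
open import Data.Product using (_×_; _,_; ∃)
open import Data.Sum using (inj₁; inj₂)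
open import Function using (_∘_)
open import Relation.Binary.PropositionalEquality using (_≡_; _≢_; refl; sym; trans; cong; cong₂; subst)
open import Relation.Nullary using (Dec; yes; no)

open import Defs

-- A record rather than g ∈ options G: a record type is injective, so Agda can infer G and g.
infix 4 _⟶_
record _⟶_ (G g : Game) : Set where
  constructor move
  field option : g ∈ options G

types≡map : ∀ gs → types gs ≡ map type gs
types≡map [] = refl
types≡map (g ∷ gs) = cong (type g ∷_) (types≡map gs)

lefts≡map : ∀ gs H → lefts gs H ≡ map (_⊕ H) gs
lefts≡map [] H = refl
lefts≡map (g ∷ gs) H = cong (g ⊕ H ∷_) (lefts≡map gs H)

rights≡map : ∀ G hs → rights G hs ≡ map (G ⊕_) hs
rights≡map G [] = refl
rights≡map G (h ∷ hs) = cong (G ⊕ h ∷_) (rights≡map G hs)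

options-⊕ : ∀ G H → options (G ⊕ H) ≡ map (_⊕ H) (options G) ++ map (G ⊕_) (options H)
options-⊕ (mk gs) (mk hs) = cong₂ _++_ (lefts≡map gs (mk hs)) (rights≡map (mk gs) hs)

PreservesMoves : (Game → Game) → Set
PreservesMoves C = ∀ {G g} → G ⟶ g → C G ⟶ C g

∘-preservesMoves : ∀ {C D} → PreservesMoves C → PreservesMoves D → PreservesMoves (λ g → C (D g))
∘-preservesMoves preservesC preservesD G⟶g = preservesC (preservesD G⟶g)

⊕-moveˡ : ∀ H → PreservesMoves (_⊕ H)
⊕-moveˡ H {G} {g} (move g∈) =
  move (subst (g ⊕ H ∈_) (sym (options-⊕ G H)) (∈-++⁺ˡ (∈-map⁺ (_⊕ H) g∈)))

⊕-moveʳ : ∀ G → PreservesMoves (G ⊕_)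
⊕-moveʳ G {H} {h} (move h∈) =
  move (subst (G ⊕ h ∈_) (sym (options-⊕ G H))
    (∈-++⁺ʳ (map (_⊕ H) (options G)) (∈-map⁺ (G ⊕_) h∈)))

first-move : ∀ g gs → mk (g ∷ gs) ⟶ g
first-move g gs = move (here refl)

data ⊕-Move (G H : Game) : Game → Set where
  left  : ∀ {g} → G ⟶ g → ⊕-Move G H (g ⊕ H)
  right : ∀ {h} → H ⟶ h → ⊕-Move G H (G ⊕ h)

⊕-move-view : ∀ G H {x} → G ⊕ H ⟶ x → ⊕-Move G H x
⊕-move-view G H (move x∈) rewrite options-⊕ G H with ∈-++⁻ (map (_⊕ H) (options G)) x∈
... | inj₁ x∈ˡ with ∈-map⁻ (_⊕ H) x∈ˡ
...   | g , g∈ , refl = left (move g∈)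
⊕-move-view G H (move x∈) | inj₂ x∈ʳ with ∈-map⁻ (G ⊕_) x∈ʳ
...   | h , h∈ , refl = right (move h∈)

nim-move : ∀ {k} m → k < m → nim m ⟶ nim k
nim-move (suc m) k<1+m with m<1+n⇒m<n∨m≡n k<1+m
... | inj₁ k<m = move (∈-++⁺ˡ (_⟶_.option (nim-move m k<m)))
... | inj₂ refl = move (∈-++⁺ʳ (heaps m) (here refl))

data NimMove (m : ℕ) : Game → Set where
  heap : ∀ {k} → k < m → NimMove m (nim k)

nim-move-view : ∀ m {g} → nim m ⟶ g → NimMove m g
nim-move-view (suc m) (move g∈) with ∈-++⁻ (heaps m) g∈
... | inj₁ g∈ᵢ with nim-move-view m (move g∈ᵢ)
...   | heap k<m = heap (m<n⇒m<1+n k<m)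
nim-move-view (suc m) (move g∈) | inj₂ (here refl) = heap (n<1+n m)

allB-∈ : ∀ {p t} ts → allB p ts ≡ true → t ∈ ts → p t ≡ true
allB-∈ (t ∷ ts) all (here refl) = ∧-conicalˡ _ _ all
allB-∈ (t ∷ ts) all (there t∈) = allB-∈ ts (∧-conicalʳ _ _ all) t∈

anyB-∈ : ∀ {p} ts → anyB p ts ≡ true → ∃ λ t → t ∈ ts × p t ≡ true
anyB-∈ {p} (t ∷ ts) any with p t in pt
... | true = t , here refl , pt
... | false with anyB-∈ ts any
...   | u , u∈ , pu = u , there u∈ , pu

∈-anyB : ∀ {p t} ts → t ∈ ts → p t ≡ true → anyB p ts ≡ true
∈-anyB (t ∷ ts) (here refl) pt rewrite pt = refl
∈-anyB {p} (u ∷ ts) (there t∈) pt with p u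
... | true = refl
... | false = ∈-anyB ts t∈ pt

isN-sound : ∀ {t} → isN t ≡ true → t ≡ 𝒩
isN-sound {𝒩} _ = refl

isO-sound : ∀ {t} → isO t ≡ true → t ≡ 𝒪
isO-sound {𝒪} _ = refl

isP-sound : ∀ {t} → isP t ≡ true → t ≡ 𝒫
isP-sound {𝒫} _ = refl

classify-𝒩 : ∀ ts → classify ts ≡ 𝒩 → anyB isP ts ≡ true
classify-𝒩 ts eq with anyB isP ts | nonEmpty ts ∧ allB isN ts | allB isO ts | eq
... | true  | _     | _     | _ = refl
... | false | true  | _     | ()
... | false | false | true  | ()
... | false | false | false | ()

classify-𝒪 : ∀ ts → classify ts ≡ 𝒪 → nonEmpty ts ∧ allB isN ts ≡ true
classify-𝒪 ts eq with anyB isP ts | nonEmpty ts ∧ allB isN ts | allB isO ts | eq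
... | false | true  | _     | _ = refl
... | true  | _     | _     | ()
... | false | false | true  | ()
... | false | false | false | ()

classify-𝒫 : ∀ ts → classify ts ≡ 𝒫 → allB isO ts ≡ true
classify-𝒫 ts eq with anyB isP ts | nonEmpty ts ∧ allB isN ts | allB isO ts | eq
... | false | false | true  | _ = refl
... | true  | _     | _     | ()
... | false | true  | _     | ()
... | false | false | false | ()

type∈types : ∀ {g gs} → g ∈ gs → type g ∈ types gs
type∈types {g} {gs} g∈ rewrite types≡map gs = ∈-map⁺ type g∈

𝒫⟶𝒪 : ∀ {G g} → type G ≡ 𝒫 → G ⟶ g → type g ≡ 𝒪
𝒫⟶𝒪 {mk gs} G-𝒫 (move g∈) =
  isO-sound (allB-∈ (types gs) (classify-𝒫 (types gs) G-𝒫) (type∈types g∈))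

𝒪⟶𝒩 : ∀ {G g} → type G ≡ 𝒪 → G ⟶ g → type g ≡ 𝒩
𝒪⟶𝒩 {mk gs} G-𝒪 (move g∈) =
  isN-sound (allB-∈ (types gs) (∧-conicalʳ _ _ (classify-𝒪 (types gs) G-𝒪)) (type∈types g∈))

𝒩⇒∃move-to-𝒫 : ∀ G → type G ≡ 𝒩 → ∃ λ g → G ⟶ g × type g ≡ 𝒫
𝒩⇒∃move-to-𝒫 (mk gs) G-𝒩 with anyB-∈ (types gs) (classify-𝒩 (types gs) G-𝒩)
... | t , t∈ , isP-t rewrite types≡map gs with ∈-map⁻ type t∈
...   | g , g∈ , refl = g , move g∈ , isP-sound isP-t

move-to-𝒫⇒𝒩 : ∀ {G g} → G ⟶ g → type g ≡ 𝒫 → type G ≡ 𝒩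
move-to-𝒫⇒𝒩 {mk gs} (move g∈) g-𝒫
  rewrite ∈-anyB {isP} (types gs) (type∈types g∈) (cong isP g-𝒫) = refl

𝒫-grandoption-not-𝒫-option : ∀ {S T a b} → type S ≡ 𝒫 → type T ≡ 𝒫 →
  S ⟶ a → T ⟶ b → b ⟶ a → ⊥
𝒫-grandoption-not-𝒫-option S-𝒫 T-𝒫 S⟶a T⟶b b⟶a
  with 𝒫⟶𝒪 S-𝒫 S⟶a | 𝒪⟶𝒩 (𝒫⟶𝒪 T-𝒫 T⟶b) b⟶a
... | a-𝒪 | a-𝒩 with trans (sym a-𝒪) a-𝒩
... | ()

triangle⇒type≢𝒫 : ∀ {S a b} → S ⟶ a → S ⟶ b → b ⟶ a → type S ≢ 𝒫
triangle⇒type≢𝒫 S⟶a S⟶b b⟶a S-𝒫 = 𝒫-grandoption-not-𝒫-option S-𝒫 S-𝒫 S⟶a S⟶b b⟶a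

type≢𝒩 : ∀ {S} → (∀ {g} → S ⟶ g → type g ≢ 𝒫) → type S ≢ 𝒩
type≢𝒩 no-move-to-𝒫 S-𝒩 with 𝒩⇒∃move-to-𝒫 _ S-𝒩
... | g , S⟶g , g-𝒫 = no-move-to-𝒫 S⟶g g-𝒫

type≢𝒪 : ∀ {S g} → S ⟶ g → type g ≢ 𝒩 → type S ≢ 𝒪
type≢𝒪 S⟶g g≢𝒩 S-𝒪 = g≢𝒩 (𝒪⟶𝒩 S-𝒪 S⟶g)

type≡𝒬 : ∀ S → type S ≢ 𝒩 → type S ≢ 𝒪 → type S ≢ 𝒫 → type S ≡ 𝒬
type≡𝒬 S ≢𝒩 ≢𝒪 ≢𝒫 with type S
... | 𝒩 = ⊥-elim (≢𝒩 refl)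
... | 𝒪 = ⊥-elim (≢𝒪 refl)
... | 𝒫 = ⊥-elim (≢𝒫 refl)
... | 𝒬 = refl

heap≥2⇒type≢𝒫 : ∀ {C m} → PreservesMoves C → 2 ≤ m → type (C (nim m)) ≢ 𝒫
heap≥2⇒type≢𝒫 {m = m} preserves 2≤m = triangle⇒type≢𝒫
  (preserves (nim-move m (≤-trans (s≤s z≤n) 2≤m)))
  (preserves (nim-move m 2≤m))
  (preserves (nim-move 1 (s≤s z≤n)))

shared-move-to-𝒫⇒type≡ : ∀ {S T a} → S ⟶ a → T ⟶ a → type a ≡ 𝒫 → type S ≡ type T
shared-move-to-𝒫⇒type≡ S⟶a T⟶a a-𝒫 =
  trans (move-to-𝒫⇒𝒩 S⟶a a-𝒫) (sym (move-to-𝒫⇒𝒩 T⟶a a-𝒫))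

≡𝒫? : ∀ t → Dec (t ≡ 𝒫)
≡𝒫? 𝒫 = yes refl
≡𝒫? 𝒩 = no λ ()
≡𝒫? 𝒪 = no λ ()
≡𝒫? 𝒬 = no λ ()

type≡-by-shared-moves : ∀ {S T a b} → S ⟶ a → T ⟶ a → S ⟶ b → T ⟶ b →
  (type a ≢ 𝒫 → type b ≢ 𝒫 → type S ≡ type T) → type S ≡ type T
type≡-by-shared-moves {a = a} {b = b} S⟶a T⟶a S⟶b T⟶b otherwise
  with ≡𝒫? (type a) | ≡𝒫? (type b)
... | yes a-𝒫 | _ = shared-move-to-𝒫⇒type≡ S⟶a T⟶a a-𝒫
... | no _ | yes b-𝒫 = shared-move-to-𝒫⇒type≡ S⟶b T⟶b b-𝒫
... | no a≢𝒫 | no b≢𝒫 = otherwise a≢𝒫 b≢𝒫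

-- In the names below, numerals and m, n stand for Nim heaps, capitals for arbitrary games.
m⊕X≢𝒫 : ∀ X {m} → 2 ≤ m → type (nim m ⊕ X) ≢ 𝒫
m⊕X≢𝒫 X = heap≥2⇒type≢𝒫 (⊕-moveˡ X)

module _ (X : Game) (0⊕X≢𝒫 : type (nim 0 ⊕ X) ≢ 𝒫) (1⊕X≢𝒫 : type (nim 1 ⊕ X) ≢ 𝒫) where

  m⊕X≢𝒩 : ∀ {m} → 2 ≤ m → type (nim m ⊕ X) ≢ 𝒩
  m⊕X≢𝒩 {m} 2≤m = type≢𝒩 (λ S⟶g → no-𝒫 (⊕-move-view (nim m) X S⟶g))
    where
    no-𝒫 : ∀ {g} → ⊕-Move (nim m) X g → type g ≢ 𝒫
    no-𝒫 (left m⟶k) with nim-move-view m m⟶k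
    ... | heap {0} _ = 0⊕X≢𝒫
    ... | heap {1} _ = 1⊕X≢𝒫
    ... | heap {suc (suc k)} _ = m⊕X≢𝒫 X {2 + k} (s≤s (s≤s z≤n))
    no-𝒫 (right {x} _) = m⊕X≢𝒫 x 2≤m

  m⊕X≡𝒬 : ∀ {m} → 3 ≤ m → type (nim m ⊕ X) ≡ 𝒬
  m⊕X≡𝒬 {m} 3≤m = type≡𝒬 (nim m ⊕ X) (m⊕X≢𝒩 2≤m)
    (type≢𝒪 (⊕-moveˡ X (nim-move m 3≤m)) (m⊕X≢𝒩 ≤-refl)) (m⊕X≢𝒫 X 2≤m)
    where
    2≤m : 2 ≤ m
    2≤m = ≤-trans (n≤1+n 2) 3≤m

nim≈nim : ∀ m n → 3 ≤ m → 3 ≤ n → nim m ≈g nim n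
nim≈nim m n 3≤m 3≤n X = type≡-by-shared-moves
  (⊕-moveˡ X (nim-move m (≤-trans (s≤s z≤n) 3≤m)))
  (⊕-moveˡ X (nim-move n (≤-trans (s≤s z≤n) 3≤n)))
  (⊕-moveˡ X (nim-move m (≤-trans (s≤s (s≤s z≤n)) 3≤m)))
  (⊕-moveˡ X (nim-move n (≤-trans (s≤s (s≤s z≤n)) 3≤n)))
  λ 0⊕X≢𝒫 1⊕X≢𝒫 →
    trans (m⊕X≡𝒬 X 0⊕X≢𝒫 1⊕X≢𝒫 3≤m) (sym (m⊕X≡𝒬 X 0⊕X≢𝒫 1⊕X≢𝒫 3≤n))

H⊕m⊕X≢𝒫 : ∀ H {m} X → 2 ≤ m → type ((H ⊕ nim m) ⊕ X) ≢ 𝒫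
H⊕m⊕X≢𝒫 H X = heap≥2⇒type≢𝒫 (∘-preservesMoves (⊕-moveˡ X) (⊕-moveʳ H))

-- The closed games 0 ⊕ 1 and 1 ⊕ 0 normalise to the same game,
-- so 1⊕0⊕X≢𝒫 also rules out (0 ⊕ 1) ⊕ X.
module _ (X : Game) (1⊕0⊕X≢𝒫 : type ((nim 1 ⊕ nim 0) ⊕ X) ≢ 𝒫) where

  0⊕2⊕X-𝒩⇒0⊕0⊕X-𝒫 : type ((nim 0 ⊕ nim 2) ⊕ X) ≡ 𝒩 → type ((nim 0 ⊕ nim 0) ⊕ X) ≡ 𝒫
  0⊕2⊕X-𝒩⇒0⊕0⊕X-𝒫 0⊕2⊕X-𝒩 with 𝒩⇒∃move-to-𝒫 _ 0⊕2⊕X-𝒩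
  ... | _ , S⟶g , g-𝒫 = only-move-to-𝒫 (⊕-move-view (nim 0 ⊕ nim 2) X S⟶g) g-𝒫
    where
    only-move-to-𝒫 : ∀ {g} → ⊕-Move (nim 0 ⊕ nim 2) X g → type g ≡ 𝒫 →
      type ((nim 0 ⊕ nim 0) ⊕ X) ≡ 𝒫
    only-move-to-𝒫 (left 0⊕2⟶) with ⊕-move-view (nim 0) (nim 2) 0⊕2⟶
    ... | left 0⟶ with nim-move-view 0 0⟶
    ...   | heap ()
    only-move-to-𝒫 (left _) | right 2⟶ with nim-move-view 2 2⟶
    ...   | heap {0} _ = λ 0⊕0⊕X-𝒫 → 0⊕0⊕X-𝒫
    ...   | heap {1} _ = ⊥-elim ∘ 1⊕0⊕X≢𝒫
    ...   | heap {suc (suc _)} (s≤s (s≤s ()))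
    only-move-to-𝒫 (right {x} _) = ⊥-elim ∘ H⊕m⊕X≢𝒫 (nim 0) x ≤-refl

  1⊕1⊕X-𝒩⇒∃1⊕1⊕x-𝒫 : type ((nim 1 ⊕ nim 1) ⊕ X) ≡ 𝒩 →
    ∃ λ x → X ⟶ x × type ((nim 1 ⊕ nim 1) ⊕ x) ≡ 𝒫
  1⊕1⊕X-𝒩⇒∃1⊕1⊕x-𝒫 1⊕1⊕X-𝒩 with 𝒩⇒∃move-to-𝒫 _ 1⊕1⊕X-𝒩
  ... | _ , S⟶g , g-𝒫 with ⊕-move-view (nim 1 ⊕ nim 1) X S⟶g
  ...   | right {x} X⟶x = x , X⟶x , g-𝒫
  ...   | left 1⊕1⟶ with ⊕-move-view (nim 1) (nim 1) 1⊕1⟶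
  ...     | left 1⟶ with nim-move-view 1 1⟶
  ...       | heap {0} _ = ⊥-elim (1⊕0⊕X≢𝒫 g-𝒫)
  ...       | heap {suc _} (s≤s ())
  1⊕1⊕X-𝒩⇒∃1⊕1⊕x-𝒫 _ | _ , _ , g-𝒫 | left _ | right 1⟶ with nim-move-view 1 1⟶
  ...       | heap {0} _ = ⊥-elim (1⊕0⊕X≢𝒫 g-𝒫)
  ...       | heap {suc _} (s≤s ())

  -- If 1 ⊕ 2 ⊕ X were 𝒪, its 𝒩-options 0 ⊕ 2 ⊕ X and 1 ⊕ 1 ⊕ X would force 0 ⊕ 0 ⊕ X and some
  -- 1 ⊕ 1 ⊕ x to be 𝒫, making 0 ⊕ 0 ⊕ x an option of one 𝒫-game and a grandoption of another.
  1⊕2⊕X≢𝒪 : type ((nim 1 ⊕ nim 2) ⊕ X) ≢ 𝒪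
  1⊕2⊕X≢𝒪 S-𝒪 =
    no-𝒫-move (1⊕1⊕X-𝒩⇒∃1⊕1⊕x-𝒫 (𝒪⟶𝒩 S-𝒪 (⊕-moveˡ X (⊕-moveʳ (nim 1) (nim-move 2 ≤-refl)))))
    where
    1⟶0 : nim 1 ⟶ nim 0
    1⟶0 = nim-move 1 (s≤s z≤n)
    0⊕0⊕X-𝒫 : type ((nim 0 ⊕ nim 0) ⊕ X) ≡ 𝒫
    0⊕0⊕X-𝒫 = 0⊕2⊕X-𝒩⇒0⊕0⊕X-𝒫 (𝒪⟶𝒩 S-𝒪 (⊕-moveˡ X (⊕-moveˡ (nim 2) 1⟶0)))
    no-𝒫-move : (∃ λ x → X ⟶ x × type ((nim 1 ⊕ nim 1) ⊕ x) ≡ 𝒫) → ⊥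
    no-𝒫-move (x , X⟶x , 1⊕1⊕x-𝒫) = 𝒫-grandoption-not-𝒫-option 0⊕0⊕X-𝒫 1⊕1⊕x-𝒫
      (⊕-moveʳ (nim 0 ⊕ nim 0) X⟶x) (⊕-moveˡ x (⊕-moveʳ (nim 1) 1⟶0))
      (⊕-moveˡ x (⊕-moveˡ (nim 0) 1⟶0))

module _ (X : Game) (1⊕0⊕X≢𝒫 : type ((nim 1 ⊕ nim 0) ⊕ X) ≢ 𝒫)
         (1⊕1⊕X≢𝒫 : type ((nim 1 ⊕ nim 1) ⊕ X) ≢ 𝒫) where

  1⊕m⊕X≢𝒩 : ∀ {m} → 2 ≤ m → type ((nim 1 ⊕ nim m) ⊕ X) ≢ 𝒩
  1⊕m⊕X≢𝒩 {m} 2≤m = type≢𝒩 (λ S⟶g → no-𝒫 (⊕-move-view (nim 1 ⊕ nim m) X S⟶g))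
    where
    no-𝒫 : ∀ {g} → ⊕-Move (nim 1 ⊕ nim m) X g → type g ≢ 𝒫
    no-𝒫 (left 1⊕m⟶) with ⊕-move-view (nim 1) (nim m) 1⊕m⟶
    ... | left 1⟶ with nim-move-view 1 1⟶
    ...   | heap {0} _ = H⊕m⊕X≢𝒫 (nim 0) X 2≤m
    ...   | heap {suc _} (s≤s ())
    no-𝒫 (left _) | right m⟶ with nim-move-view m m⟶
    ...   | heap {0} _ = 1⊕0⊕X≢𝒫
    ...   | heap {1} _ = 1⊕1⊕X≢𝒫
    ...   | heap {suc (suc k)} _ = H⊕m⊕X≢𝒫 (nim 1) {2 + k} X (s≤s (s≤s z≤n))
    no-𝒫 (right {x} _) = H⊕m⊕X≢𝒫 (nim 1) x 2≤m

  1⊕m⊕X≢𝒪 : ∀ {m} → 2 ≤ m → type ((nim 1 ⊕ nim m) ⊕ X) ≢ 𝒪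
  1⊕m⊕X≢𝒪 {suc zero} (s≤s ())
  1⊕m⊕X≢𝒪 {suc (suc zero)} _ = 1⊕2⊕X≢𝒪 X 1⊕0⊕X≢𝒫
  1⊕m⊕X≢𝒪 {suc (suc (suc k))} _ =
    type≢𝒪 (⊕-moveˡ X (⊕-moveʳ (nim 1) (nim-move (3 + k) (s≤s (s≤s (s≤s z≤n))))))
      (1⊕m⊕X≢𝒩 ≤-refl)

  1⊕m⊕X≡𝒬 : ∀ {m} → 2 ≤ m → type ((nim 1 ⊕ nim m) ⊕ X) ≡ 𝒬
  1⊕m⊕X≡𝒬 {m} 2≤m = type≡𝒬 ((nim 1 ⊕ nim m) ⊕ X)
    (1⊕m⊕X≢𝒩 2≤m) (1⊕m⊕X≢𝒪 2≤m) (H⊕m⊕X≢𝒫 (nim 1) X 2≤m)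

1⊕m≈1⊕n : ∀ m n → 2 ≤ m → 2 ≤ n → nim 1 ⊕ nim m ≈g nim 1 ⊕ nim n
1⊕m≈1⊕n m n 2≤m 2≤n X = type≡-by-shared-moves
  (⊕-moveˡ X (⊕-moveʳ (nim 1) (nim-move m (≤-trans (s≤s z≤n) 2≤m))))
  (⊕-moveˡ X (⊕-moveʳ (nim 1) (nim-move n (≤-trans (s≤s z≤n) 2≤n))))
  (⊕-moveˡ X (⊕-moveʳ (nim 1) (nim-move m 2≤m)))
  (⊕-moveˡ X (⊕-moveʳ (nim 1) (nim-move n 2≤n)))
  λ 1⊕0⊕X≢𝒫 1⊕1⊕X≢𝒫 →
    trans (1⊕m⊕X≡𝒬 X 1⊕0⊕X≢𝒫 1⊕1⊕X≢𝒫 2≤m) (sym (1⊕m⊕X≡𝒬 X 1⊕0⊕X≢𝒫 1⊕1⊕X≢𝒫 2≤n))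

H⊕m⊕K⊕X≢𝒫 : ∀ H {m} K X → 2 ≤ m → type (((H ⊕ nim m) ⊕ K) ⊕ X) ≢ 𝒫
H⊕m⊕K⊕X≢𝒫 H K X =
  heap≥2⇒type≢𝒫 (∘-preservesMoves (⊕-moveˡ X) (∘-preservesMoves (⊕-moveˡ K) (⊕-moveʳ H)))

G⊕m⊕n⊕X≢𝒩 : ∀ G {m n} X → 2 ≤ m → 2 ≤ n → type (((G ⊕ nim m) ⊕ nim n) ⊕ X) ≢ 𝒩
G⊕m⊕n⊕X≢𝒩 G {m} {n} X 2≤m 2≤n =
  type≢𝒩 (λ S⟶g → no-𝒫 (⊕-move-view ((G ⊕ nim m) ⊕ nim n) X S⟶g))
  where
  no-𝒫 : ∀ {g} → ⊕-Move ((G ⊕ nim m) ⊕ nim n) X g → type g ≢ 𝒫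
  no-𝒫 (right {x} _) = H⊕m⊕K⊕X≢𝒫 G (nim n) x 2≤m
  no-𝒫 (left G⊕m⊕n⟶) with ⊕-move-view (G ⊕ nim m) (nim n) G⊕m⊕n⟶
  ... | right {K} _ = H⊕m⊕K⊕X≢𝒫 G K X 2≤m
  ... | left G⊕m⟶ with ⊕-move-view G (nim m) G⊕m⟶
  ...   | left {g} _ = H⊕m⊕K⊕X≢𝒫 g (nim n) X 2≤m
  ...   | right {K} _ = H⊕m⊕X≢𝒫 (G ⊕ K) X 2≤n

G⊕m⊕n⊕X≢𝒪 : ∀ G {m n} X → 2 ≤ m → 2 ≤ n → type (((G ⊕ nim m) ⊕ nim n) ⊕ X) ≢ 𝒪
G⊕m⊕n⊕X≢𝒪 G {suc (suc (suc m))} {n} X _ 2≤n = type≢𝒪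
  (⊕-moveˡ X (⊕-moveˡ (nim n) (⊕-moveʳ G (nim-move (3 + m) (s≤s (s≤s (s≤s z≤n)))))))
  (G⊕m⊕n⊕X≢𝒩 G X ≤-refl 2≤n)
G⊕m⊕n⊕X≢𝒪 G {m} {suc (suc (suc n))} X 2≤m _ = type≢𝒪
  (⊕-moveˡ X (⊕-moveʳ (G ⊕ nim m) (nim-move (3 + n) (s≤s (s≤s (s≤s z≤n))))))
  (G⊕m⊕n⊕X≢𝒩 G X 2≤m ≤-refl)
G⊕m⊕n⊕X≢𝒪 (mk (g ∷ gs)) {2} {2} X _ _ = type≢𝒪
  (⊕-moveˡ X (⊕-moveˡ (nim 2) (⊕-moveˡ (nim 2) (first-move g gs))))
  (G⊕m⊕n⊕X≢𝒩 g X ≤-refl ≤-refl)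
G⊕m⊕n⊕X≢𝒪 (mk []) {2} {2} (mk (x ∷ xs)) _ _ = type≢𝒪
  (⊕-moveʳ ((mk [] ⊕ nim 2) ⊕ nim 2) (first-move x xs))
  (G⊕m⊕n⊕X≢𝒩 (mk []) x ≤-refl ≤-refl)
-- 0 ⊕ 2 ⊕ 2 ⊕ 0 has no option of this shape; its type is computed.
G⊕m⊕n⊕X≢𝒪 (mk []) {2} {2} (mk []) _ _ ()
G⊕m⊕n⊕X≢𝒪 _ {1} _ (s≤s ()) _
G⊕m⊕n⊕X≢𝒪 _ {_} {1} _ _ (s≤s ())

G⊕m⊕n⊕X≡𝒬 : ∀ G {m n} X → 2 ≤ m → 2 ≤ n → type (((G ⊕ nim m) ⊕ nim n) ⊕ X) ≡ 𝒬
G⊕m⊕n⊕X≡𝒬 G {m} {n} X 2≤m 2≤n = type≡𝒬 (((G ⊕ nim m) ⊕ nim n) ⊕ X)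
  (G⊕m⊕n⊕X≢𝒩 G X 2≤m 2≤n) (G⊕m⊕n⊕X≢𝒪 G X 2≤m 2≤n) (H⊕m⊕K⊕X≢𝒫 G (nim n) X 2≤m)

G⊕m⊕n≈2⊕2 : ∀ G m n → 2 ≤ m → 2 ≤ n → G ⊕ nim m ⊕ nim n ≈g nim 2 ⊕ nim 2
-- The closed games 0 ⊕ 2 ⊕ 2 and 2 ⊕ 2 normalise to the same game.
G⊕m⊕n≈2⊕2 G m n 2≤m 2≤n X =
  trans (G⊕m⊕n⊕X≡𝒬 G X 2≤m 2≤n) (sym (G⊕m⊕n⊕X≡𝒬 (nim 0) X ≤-refl ≤-refl))

claim12 : ((m n : ℕ) → 3 ≤ m → 3 ≤ n → nim m ≈g nim n)
    × ((m n : ℕ) → 2 ≤ m → 2 ≤ n → nim 1 ⊕ nim m ≈g nim 1 ⊕ nim n)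
    × ((G : Game) (m n : ℕ) → 2 ≤ m → 2 ≤ n → G ⊕ nim m ⊕ nim n ≈g nim 2 ⊕ nim 2)
claim12 = nim≈nim , 1⊕m≈1⊕n , G⊕m⊕n≈2⊕2
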